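{- Let $k,\lambda$ be positive integers, let $j$ be an integer with $j\ge\lambda+1$, and let $\beta=\beta(\lambda,j)=\lceil\frac{j+\lambda-1}{2}\rceil$. Consider the problem of maximizing $aj+r$ over integers $a,r$ subject to: (1) $a\ge0$; (2) $r\in\{0,1,\ldots,j-1\}$; (3) if $r\ge\beta$, then $\beta(a+1)\le k-1$; (4) if $r\le\beta-1$, then $(a+1)r+(\beta-r)a\le k-1$. Then the maximum value is $$z_j=\left\lfloor\frac{k-1}{\beta}\right\rfloor\cdot j+(k-1)_{\bmod\beta},$$ attained at $a=\lfloor\frac{k-1}{\beta}\rfloor$ and $r=(k-1)_{\bmod\beta}$.
   Context: $(k-1)_{\bmod\beta}$ denotes the remainder of $k-1$ upon division by $\beta$. In the paper $j$ ranges over $\{\lambda+1,\ldots,d-\lambda+2\}$ for a positive integer $d\ge\lambda$. -}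

module Defs where

open import Data.Nat using (ℕ; _+_; _*_; _∸_; _≤_; _<_; ⌈_/2⌉)
open import Data.Product using (_×_)

β : ℕ → ℕ → ℕ
β l j = ⌈ (j + l ∸ 1) /2⌉

-- feasibility of (a , r) for given k, λ, j  (a ≥ 0 automatic since a : ℕ)
Feasible : (k l j a r : ℕ) → Set
Feasible k l j a r =
  (r < j)
  × (β l j ≤ r → β l j * (a + 1) ≤ k ∸ 1)
  × (r < β l j → (a + 1) * r + (β l j ∸ r) * a ≤ k ∸ 1)

-- With b = β and q, s the quotient and remainder of k - 1 by b, constraint (4) reads
-- r + a b ≤ k - 1 = s + q b, while (3) gives (a + 1) b ≤ k - 1.  Either way the pair
-- (a, r) is lexicographically at most (q, s), and (q, s) itself is feasible since s < b ≤ j.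
-- A pair of digits with r < j that is lexicographically smaller gives a smaller
-- number a j + r in base j, so (q, s) maximises the objective.
module Submission where

open import Defs
open import Data.Nat using (ℕ; suc; _+_; _*_; _∸_; _≤_; _<_; NonZero; _/_; _%_; _<?_)
open import Data.Nat.DivMod using (m≡m%n+[m/n]*n; m%n<n; m*n/n≡m; /-monoˡ-≤)
open import Data.Nat.Properties
open import Data.Nat.Tactic.RingSolver using (solve-∀)
open import Data.Product using (_×_; _,_)
open import Data.Product.Relation.Binary.Lex.Strict using (×-Lex)
open import Data.Sum using (inj₁; inj₂)
open import Relation.Binary.PropositionalEquality using (_≡_; refl; sym; trans; cong; subst; module ≡-Reasoning)
open import Relation.Nullary using (yes; no; contradiction)

infix 4 _≤ₗₑₓ_

_≤ₗₑₓ_ : ℕ × ℕ → ℕ × ℕ → Set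
_≤ₗₑₓ_ = ×-Lex _≡_ _<_ _≤_

β≤j : ∀ l j → l ≤ suc j → β l j ≤ j
β≤j l j l≤1+j = subst (β l j ≤_) (sym (n≡⌈n+n/2⌉ j))
  (⌈n/2⌉-mono (m≤n+o⇒m∸n≤o (j + l) 1 (subst (j + l ≤_) (+-suc j j) (+-monoʳ-≤ j l≤1+j))))

[a+1]*r+d*a≡r+a*[r+d] : ∀ a r d → (a + 1) * r + d * a ≡ r + a * (r + d)
[a+1]*r+d*a≡r+a*[r+d] = solve-∀

[a+1]*r+[b∸r]*a≡r+a*b : ∀ a {r b} → r ≤ b → (a + 1) * r + (b ∸ r) * a ≡ r + a * b
[a+1]*r+[b∸r]*a≡r+a*b a {r} {b} r≤b = begin
  (a + 1) * r + (b ∸ r) * a  ≡⟨ [a+1]*r+d*a≡r+a*[r+d] a r (b ∸ r) ⟩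
  r + a * (r + (b ∸ r))      ≡⟨ cong (λ x → r + a * x) (m+[n∸m]≡n r≤b) ⟩
  r + a * b                  ∎
  where open ≡-Reasoning

*-≤⇒≤-/ : ∀ a b {n} .{{_ : NonZero b}} → a * b ≤ n → a ≤ n / b
*-≤⇒≤-/ a b a*b≤n = subst (_≤ _) (m*n/n≡m a b) (/-monoˡ-≤ b a*b≤n)

+-*-≤⇒≤ₗₑₓ-divMod : ∀ a r b {n} .{{_ : NonZero b}} →
  r + a * b ≤ n → (a , r) ≤ₗₑₓ (n / b , n % b)
+-*-≤⇒≤ₗₑₓ-divMod a r b {n} r+a*b≤n
  with m≤n⇒m<n∨m≡n (*-≤⇒≤-/ a b (≤-trans (m≤n+m (a * b) r) r+a*b≤n))
... | inj₁ a<q  = inj₁ a<q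
... | inj₂ refl = inj₂ (refl , +-cancelʳ-≤ (a * b) r (n % b)
                               (subst (r + a * b ≤_) (m≡m%n+[m/n]*n n b) r+a*b≤n))

≤ₗₑₓ⇒*-+-≤ : ∀ {a r q s} j → r < j → (a , r) ≤ₗₑₓ (q , s) → a * j + r ≤ q * j + s
≤ₗₑₓ⇒*-+-≤ {a} {r} {q} {s} j r<j (inj₁ a<q) = begin
  a * j + r  ≤⟨ +-monoʳ-≤ (a * j) (<⇒≤ r<j) ⟩
  a * j + j  ≡⟨ +-comm (a * j) j ⟩
  suc a * j  ≤⟨ *-monoˡ-≤ j a<q ⟩
  q * j      ≤⟨ m≤m+n (q * j) s ⟩
  q * j + s  ∎
  where open ≤-Reasoning
≤ₗₑₓ⇒*-+-≤ {a} j _ (inj₂ (refl , r≤s)) = +-monoʳ-≤ (a * j) r≤s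

module _ (k l j : ℕ) .{{_ : NonZero (β l j)}} where

  private
    b = β l j
    q = (k ∸ 1) / b
    s = (k ∸ 1) % b

  feasible-divMod : l ≤ suc j → Feasible k l j q s
  feasible-divMod l≤1+j =
      <-≤-trans (m%n<n (k ∸ 1) b) (β≤j l j l≤1+j)
    , (λ b≤s → contradiction (m%n<n (k ∸ 1) b) (≤⇒≯ b≤s))
    , (λ _ → ≤-reflexive (begin
        (q + 1) * s + (b ∸ s) * q  ≡⟨ [a+1]*r+[b∸r]*a≡r+a*b q (<⇒≤ (m%n<n (k ∸ 1) b)) ⟩
        s + q * b                  ≡⟨ m≡m%n+[m/n]*n (k ∸ 1) b ⟨
        k ∸ 1                      ∎))
    where open ≡-Reasoning

  feasible⇒≤ₗₑₓ-divMod : ∀ {a r} → Feasible k l j a r → (a , r) ≤ₗₑₓ (q , s)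
  feasible⇒≤ₗₑₓ-divMod {a} {r} (_ , when-β≤r , when-r<β) with r <? b
  ... | yes r<b = +-*-≤⇒≤ₗₑₓ-divMod a r b
                    (subst (_≤ k ∸ 1) ([a+1]*r+[b∸r]*a≡r+a*b a (<⇒≤ r<b)) (when-r<β r<b))
  ... | no r≮b  = inj₁ (*-≤⇒≤-/ (suc a) b
                    (subst (_≤ k ∸ 1) (trans (*-comm b (a + 1)) (cong (_* b) (+-comm a 1))) (when-β≤r (≮⇒≥ r≮b))))

proposition6 : (k l j : ℕ) → 1 ≤ k → 1 ≤ l → l + 1 ≤ j →
    .{{_ : NonZero (β l j)}} →
    Feasible k l j ((k ∸ 1) / β l j) ((k ∸ 1) % β l j)
    × (∀ a r → Feasible k l j a r →
         a * j + r ≤ ((k ∸ 1) / β l j) * j + (k ∸ 1) % β l j)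
proposition6 k l j _ _ l+1≤j =
    feasible-divMod k l j (m≤n⇒m≤1+n (≤-trans (m≤m+n l 1) l+1≤j))
  , λ a r feasible@(r<j , _) → ≤ₗₑₓ⇒*-+-≤ j r<j (feasible⇒≤ₗₑₓ-divMod k l j feasible)
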